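{- Let $m,n$ be positive integers and let $R=(r_1,\ldots,r_m)$ and $S=(s_1,\ldots,s_n)$ be nonnegative integral vectors. Then $R$ and $S$ are the row sum vector and column sum vector, respectively, of some $m\times n$ sign-restricted matrix $A$ if and only if $S$ is a $(0,1)$-vector and $\sum_{i=1}^m r_i=\sum_{j=1}^n s_j$. Moreover, in that case $A$ can be chosen to be a sign-restricted matrix with no entry equal to $-1$ (i.e., a $(0,1)$-matrix).
   Context: A sign-restricted matrix (SRM) is an $m\times n$ matrix $A=[a_{ij}]$ with entries in $\{0,1,-1\}$ such that every partial column sum $\sum_{k=1}^{i} a_{kj}$ ($1\le i\le m$, $1\le j\le n$) equals $0$ or $1$, and every partial row sum $\sum_{l=1}^{j} a_{il}$ ($1\le i\le m$, $1\le j\le n$) is nonnegative. -}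

module Defs where

open import Data.Nat using (ℕ; zero; suc)
open import Data.Fin using (Fin; zero; suc)
open import Data.Integer using (ℤ; +_; -[1+_]; _+_; 0ℤ; 1ℤ; _≤_)
open import Data.Product using (_×_)
open import Data.Sum using (_⊎_)
open import Relation.Binary.PropositionalEquality using (_≡_)

sumℤ : ∀ {k} → (Fin k → ℤ) → ℤ
sumℤ {zero} v = 0ℤ
sumℤ {suc k} v = v zero + sumℤ (λ i → v (suc i))

sumℕ : ∀ {k} → (Fin k → ℕ) → ℕ
sumℕ {zero} v = 0
sumℕ {suc k} v = v zero Data.Nat.+ sumℕ (λ i → v (suc i))

-- partial sum  v₁ + … + v_{i+1}  (entries with index ≤ i, 0-based)
partialSum : ∀ {k} → (Fin k → ℤ) → Fin k → ℤ
partialSum v zero = v zero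
partialSum v (suc i) = v zero + partialSum (λ j → v (suc j)) i

Matrix : ℕ → ℕ → Set
Matrix m n = Fin m → Fin n → ℤ

row : ∀ {m n} → Matrix m n → Fin m → Fin n → ℤ
row A i = A i

col : ∀ {m n} → Matrix m n → Fin n → Fin m → ℤ
col A j i = A i j

IsSignEntry : ℤ → Set
IsSignEntry x = (x ≡ 0ℤ) ⊎ ((x ≡ 1ℤ) ⊎ (x ≡ -[1+ 0 ]))

Is01 : ℤ → Set
Is01 x = (x ≡ 0ℤ) ⊎ (x ≡ 1ℤ)

IsSRM : ∀ {m n} → Matrix m n → Set
IsSRM {m} {n} A =
  ((i : Fin m) (j : Fin n) → IsSignEntry (A i j)) ×
  (((j : Fin n) (i : Fin m) → Is01 (partialSum (col A j) i)) ×
   ((i : Fin m) (j : Fin n) → 0ℤ ≤ partialSum (row A i) j))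

Is01Matrix : ∀ {m n} → Matrix m n → Set
Is01Matrix {m} {n} A = (i : Fin m) (j : Fin n) → Is01 (A i j)

rowSums : ∀ {m n} → Matrix m n → Fin m → ℤ
rowSums A i = sumℤ (row A i)

colSums : ∀ {m n} → Matrix m n → Fin n → ℤ
colSums A j = sumℤ (col A j)

Is01Vec : ∀ {k} → (Fin k → ℕ) → Set
Is01Vec {k} s = (j : Fin k) → (s j ≡ 0) ⊎ (s j ≡ 1)

-- Necessity: the column sum is the last partial column sum, hence 0 or 1, and
-- the total of the row sums equals the total of the column sums.  Sufficiency:
-- fill the columns one at a time; a column with sum 1 gets a single 1 in some
-- row whose remaining row sum is still positive.  The result is a
-- (0,1)-matrix, and a (0,1)-matrix with (0,1) column sums is sign-restricted,
-- since all its partial column sums lie between 0 and the column sum.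
module Submission where

open import Defs
open import Data.Nat using (ℕ; zero; suc; _≤_; z≤n; s≤s)
  renaming (_+_ to _+ℕ_)
import Data.Nat.Properties as ℕ
open import Data.Fin using (Fin; zero; suc; fromℕ)
open import Data.Integer using (ℤ; +_; 0ℤ; +≤+) renaming (_+_ to _+ℤ_; _≤_ to _≤ℤ_)
import Data.Integer.Properties as ℤ
open import Data.Product using (_×_; ∃; _,_)
open import Data.Sum using (_⊎_; inj₁; inj₂)
open import Function using (_∘_)
open import Relation.Binary.PropositionalEquality
  using (_≡_; _≗_; refl; sym; trans; cong; cong₂; subst; module ≡-Reasoning)
import Algebra.Properties.CommutativeMonoid.Sum as CommutativeMonoidSum

private
  module ∑ℕ = CommutativeMonoidSum ℕ.+-0-commutativeMonoid
  module ∑ℤ = CommutativeMonoidSum ℤ.+-0-commutativeMonoid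

sumℕ≡sum : ∀ {k} (v : Fin k → ℕ) → sumℕ v ≡ ∑ℕ.sum v
sumℕ≡sum {zero} v = refl
sumℕ≡sum {suc k} v = cong (v zero +ℕ_) (sumℕ≡sum (v ∘ suc))

sumℤ≡sum : ∀ {k} (v : Fin k → ℤ) → sumℤ v ≡ ∑ℤ.sum v
sumℤ≡sum {zero} v = refl
sumℤ≡sum {suc k} v = cong (v zero +ℤ_) (sumℤ≡sum (v ∘ suc))

sumℕ-zero : ∀ k → sumℕ {k} (λ _ → 0) ≡ 0
sumℕ-zero k = trans (sumℕ≡sum {k} (λ _ → 0)) (∑ℕ.sum-replicate-zero k)

sumℕ-distrib-+ : ∀ {k} (u v : Fin k → ℕ) →
  sumℕ (λ i → u i +ℕ v i) ≡ sumℕ u +ℕ sumℕ v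
sumℕ-distrib-+ u v = begin
  sumℕ (λ i → u i +ℕ v i)   ≡⟨ sumℕ≡sum (λ i → u i +ℕ v i) ⟩
  ∑ℕ.sum (λ i → u i +ℕ v i) ≡⟨ ∑ℕ.∑-distrib-+ u v ⟩
  ∑ℕ.sum u +ℕ ∑ℕ.sum v      ≡⟨ cong₂ _+ℕ_ (sumℕ≡sum u) (sumℕ≡sum v) ⟨
  sumℕ u +ℕ sumℕ v          ∎
  where open ≡-Reasoning

sumℕ-cong : ∀ {k} {u v : Fin k → ℕ} → u ≗ v → sumℕ u ≡ sumℕ v
sumℕ-cong {u = u} {v} u≗v =
  trans (sumℕ≡sum u) (trans (∑ℕ.sum-cong-≗ u≗v) (sym (sumℕ≡sum v)))

sumℕ≡0⇒≡0 : ∀ {k} (v : Fin k → ℕ) → sumℕ v ≡ 0 → ∀ i → v i ≡ 0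
sumℕ≡0⇒≡0 v h zero    = ℕ.m+n≡0⇒m≡0 (v zero) h
sumℕ≡0⇒≡0 v h (suc i) = sumℕ≡0⇒≡0 (v ∘ suc) (ℕ.m+n≡0⇒n≡0 (v zero) h) i

sumℤ-cong : ∀ {k} {u v : Fin k → ℤ} → u ≗ v → sumℤ u ≡ sumℤ v
sumℤ-cong {u = u} {v} u≗v =
  trans (sumℤ≡sum u) (trans (∑ℤ.sum-cong-≗ u≗v) (sym (sumℤ≡sum v)))

sumℤ-comm : ∀ {m n} (f : Fin m → Fin n → ℤ) →
  sumℤ (λ i → sumℤ (f i)) ≡ sumℤ (λ j → sumℤ (λ i → f i j))
sumℤ-comm f = begin
  sumℤ (λ i → sumℤ (f i))                 ≡⟨ sumℤ≡sum (λ i → sumℤ (f i)) ⟩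
  ∑ℤ.sum (λ i → sumℤ (f i))               ≡⟨ ∑ℤ.sum-cong-≗ (sumℤ≡sum ∘ f) ⟩
  ∑ℤ.sum (λ i → ∑ℤ.sum (f i))             ≡⟨ ∑ℤ.∑-comm f ⟩
  ∑ℤ.sum (λ j → ∑ℤ.sum (λ i → f i j))     ≡⟨ ∑ℤ.sum-cong-≗ (λ j → sumℤ≡sum (λ i → f i j)) ⟨
  ∑ℤ.sum (λ j → sumℤ (λ i → f i j))       ≡⟨ sumℤ≡sum (λ j → sumℤ (λ i → f i j)) ⟨
  sumℤ (λ j → sumℤ (λ i → f i j))         ∎
  where open ≡-Reasoning

sumℤ-+ : ∀ {k} (v : Fin k → ℕ) → sumℤ (+_ ∘ v) ≡ + sumℕ v
sumℤ-+ {zero} v = refl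
sumℤ-+ {suc k} v = cong (+ v zero +ℤ_) (sumℤ-+ (v ∘ suc))

sumℤ≡partialSum-last : ∀ {k} (v : Fin (suc k) → ℤ) → sumℤ v ≡ partialSum v (fromℕ k)
sumℤ≡partialSum-last {zero} v = ℤ.+-identityʳ (v zero)
sumℤ≡partialSum-last {suc k} v = cong (v zero +ℤ_) (sumℤ≡partialSum-last (v ∘ suc))

partialSumℕ : ∀ {k} → (Fin k → ℕ) → Fin k → ℕ
partialSumℕ v zero = v zero
partialSumℕ v (suc i) = v zero +ℕ partialSumℕ (v ∘ suc) i

partialSum-+ : ∀ {k} (v : Fin k → ℕ) i → partialSum (+_ ∘ v) i ≡ + partialSumℕ v i
partialSum-+ v zero = refl
partialSum-+ v (suc i) = cong (+ v zero +ℤ_) (partialSum-+ (v ∘ suc) i)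

partialSumℕ≤sumℕ : ∀ {k} (v : Fin k → ℕ) i → partialSumℕ v i ≤ sumℕ v
partialSumℕ≤sumℕ v zero = ℕ.m≤m+n (v zero) _
partialSumℕ≤sumℕ v (suc i) = ℕ.+-monoʳ-≤ (v zero) (partialSumℕ≤sumℕ (v ∘ suc) i)

≤1⇒Is01 : ∀ {x} → x ≤ 1 → Is01 (+ x)
≤1⇒Is01 z≤n = inj₁ refl
≤1⇒Is01 (s≤s z≤n) = inj₂ refl

Is01-+⇒ : ∀ {x} → Is01 (+ x) → (x ≡ 0) ⊎ (x ≡ 1)
Is01-+⇒ (inj₁ x≡0) = inj₁ (ℤ.+-injective x≡0)
Is01-+⇒ (inj₂ x≡1) = inj₂ (ℤ.+-injective x≡1)

Is01⇒IsSignEntry : ∀ {x} → Is01 x → IsSignEntry x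
Is01⇒IsSignEntry (inj₁ x≡0) = inj₁ x≡0
Is01⇒IsSignEntry (inj₂ x≡1) = inj₂ (inj₁ x≡1)

Is01Vec⇒≤1 : ∀ {k} {s : Fin k → ℕ} → Is01Vec s → ∀ j → s j ≤ 1
Is01Vec⇒≤1 {s = s} s01 j with s j | s01 j
... | _ | inj₁ refl = z≤n
... | _ | inj₂ refl = s≤s z≤n

colSums-Is01 : ∀ {m n} (A : Matrix m n) → IsSRM A → ∀ j → Is01 (colSums A j)
colSums-Is01 {zero}  A _               j = inj₁ refl
colSums-Is01 {suc m} A (_ , colSRM , _) j =
  subst Is01 (sym (sumℤ≡partialSum-last (col A j))) (colSRM j (fromℕ m))

record ColumnSplit {m} (r : Fin m → ℕ) (s : ℕ) : Set where
  field
    column      : Fin m → ℕ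
    rest        : Fin m → ℕ
    column≤1    : ∀ i → column i ≤ 1
    column+rest : ∀ i → column i +ℕ rest i ≡ r i
    sum-column  : sumℕ column ≡ s

  sum≡s+sum-rest : sumℕ r ≡ s +ℕ sumℕ rest
  sum≡s+sum-rest = begin
    sumℕ r                                ≡⟨ sumℕ-cong column+rest ⟨
    sumℕ (λ i → column i +ℕ rest i)       ≡⟨ sumℕ-distrib-+ column rest ⟩
    sumℕ column +ℕ sumℕ rest              ≡⟨ cong (_+ℕ sumℕ rest) sum-column ⟩
    s +ℕ sumℕ rest                        ∎
    where open ≡-Reasoning

open ColumnSplit

zeroSplit : ∀ {m} (r : Fin m → ℕ) → ColumnSplit r 0
zeroSplit {m} r = record
  { column = λ _ → 0 ; rest = r ; column≤1 = λ _ → z≤n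
  ; column+rest = λ _ → refl ; sum-column = sumℕ-zero m }

unitSplit : ∀ {m} (r : Fin m → ℕ) → 1 ≤ sumℕ r → ColumnSplit r 1
unitSplit {suc m} r 1≤sum with r zero in r₀≡
... | suc r₀ = record
  { column = λ { zero → 1 ; (suc _) → 0 }
  ; rest = λ { zero → r₀ ; (suc i) → r (suc i) }
  ; column≤1 = λ { zero → s≤s z≤n ; (suc _) → z≤n }
  ; column+rest = λ { zero → sym r₀≡ ; (suc _) → refl }
  ; sum-column = cong suc (sumℕ-zero m) }
... | zero = record
  { column = λ { zero → 0 ; (suc i) → column tailSplit i }
  ; rest = λ { zero → 0 ; (suc i) → rest tailSplit i }
  ; column≤1 = λ { zero → z≤n ; (suc i) → column≤1 tailSplit i }
  ; column+rest = λ { zero → sym r₀≡ ; (suc i) → column+rest tailSplit i }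
  ; sum-column = sum-column tailSplit }
  where
  tailSplit : ColumnSplit (r ∘ suc) 1
  tailSplit = unitSplit (r ∘ suc) 1≤sum

splitOff : ∀ {m} (r : Fin m → ℕ) s → s ≤ 1 → s ≤ sumℕ r → ColumnSplit r s
splitOff r 0 _ _ = zeroSplit r
splitOff r 1 _ 1≤sum = unitSplit r 1≤sum
splitOff r (suc (suc _)) (s≤s ()) _

record ZeroOneRealisation {m n} (r : Fin m → ℕ) (s : Fin n → ℕ) : Set where
  field
    entry   : Fin m → Fin n → ℕ
    entry≤1 : ∀ i j → entry i j ≤ 1
    rowSum  : ∀ i → sumℕ (entry i) ≡ r i
    colSum  : ∀ j → sumℕ (λ i → entry i j) ≡ s j

open ZeroOneRealisation

zeroOneRealisation : ∀ {m n} (r : Fin m → ℕ) (s : Fin n → ℕ) →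
  Is01Vec s → sumℕ r ≡ sumℕ s → ZeroOneRealisation r s
zeroOneRealisation {n = zero} r s _ sum-r≡0 = record
  { entry = λ _ () ; entry≤1 = λ _ () ; colSum = λ ()
  ; rowSum = λ i → sym (sumℕ≡0⇒≡0 r sum-r≡0 i) }
zeroOneRealisation {n = suc n} r s s01 sum-r≡sum-s = record
  { entry   = λ { i zero → column split i ; i (suc j) → entry tailRealisation i j }
  ; entry≤1 = λ { i zero → column≤1 split i ; i (suc j) → entry≤1 tailRealisation i j }
  ; rowSum  = λ i → trans (cong (column split i +ℕ_) (rowSum tailRealisation i))
                          (column+rest split i)
  ; colSum  = λ { zero → sum-column split ; (suc j) → colSum tailRealisation j } }
  where
  split : ColumnSplit r (s zero)
  split = splitOff r (s zero) (Is01Vec⇒≤1 s01 zero)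
            (subst (s zero ≤_) (sym sum-r≡sum-s) (ℕ.m≤m+n (s zero) _))

  sum-rest≡sum-tail : sumℕ (rest split) ≡ sumℕ (s ∘ suc)
  sum-rest≡sum-tail =
    ℕ.+-cancelˡ-≡ (s zero) _ _ (trans (sym (sum≡s+sum-rest split)) sum-r≡sum-s)

  tailRealisation : ZeroOneRealisation (rest split) (s ∘ suc)
  tailRealisation =
    zeroOneRealisation (rest split) (s ∘ suc) (s01 ∘ suc) sum-rest≡sum-tail

01-matrix⇒IsSRM : ∀ {m n} (B : Fin m → Fin n → ℕ) → (∀ i j → B i j ≤ 1) →
  (∀ j → sumℕ (λ i → B i j) ≤ 1) → IsSRM (λ i j → + B i j)
01-matrix⇒IsSRM B entry≤1 colSum≤1 = signEntries , colPartialSums , rowPartialSums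
  where
  signEntries : ∀ i j → IsSignEntry (+ B i j)
  signEntries i j = Is01⇒IsSignEntry (≤1⇒Is01 (entry≤1 i j))

  colPartialSums : ∀ j i → Is01 (partialSum (λ k → + B k j) i)
  colPartialSums j i = subst Is01 (sym (partialSum-+ (λ k → B k j) i))
    (≤1⇒Is01 (ℕ.≤-trans (partialSumℕ≤sumℕ (λ k → B k j) i) (colSum≤1 j)))

  rowPartialSums : ∀ i j → 0ℤ ≤ℤ partialSum (λ k → + B i k) j
  rowPartialSums i j = subst (0ℤ ≤ℤ_) (sym (partialSum-+ (B i) j)) (+≤+ z≤n)

SRM-sums⇒Is01Vec×sum≡ : ∀ {m n} (R : Fin m → ℕ) (S : Fin n → ℕ) (A : Matrix m n) →
  IsSRM A → (∀ i → rowSums A i ≡ + R i) → (∀ j → colSums A j ≡ + S j) →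
  Is01Vec S × sumℕ R ≡ sumℕ S
SRM-sums⇒Is01Vec×sum≡ R S A srm rowSums≡R colSums≡S =
  (λ j → Is01-+⇒ (subst Is01 (colSums≡S j) (colSums-Is01 A srm j))) ,
  ℤ.+-injective (begin
    + sumℕ R          ≡⟨ sumℤ-+ R ⟨
    sumℤ (+_ ∘ R)     ≡⟨ sumℤ-cong rowSums≡R ⟨
    sumℤ (rowSums A)  ≡⟨ sumℤ-comm A ⟩
    sumℤ (colSums A)  ≡⟨ sumℤ-cong colSums≡S ⟩
    sumℤ (+_ ∘ S)     ≡⟨ sumℤ-+ S ⟩
    + sumℕ S          ∎)
  where open ≡-Reasoning

ZeroOneRealisation⇒SRM : ∀ {m n} {R : Fin m → ℕ} {S : Fin n → ℕ} →
  Is01Vec S → ZeroOneRealisation R S →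
  ∃ λ (A : Matrix m n) → IsSRM A × Is01Matrix A ×
    (∀ i → rowSums A i ≡ + R i) × (∀ j → colSums A j ≡ + S j)
ZeroOneRealisation⇒SRM {S = S} S01 B =
  (λ i j → + entry B i j) ,
  01-matrix⇒IsSRM (entry B) (entry≤1 B) colSum≤1 ,
  (λ i j → ≤1⇒Is01 (entry≤1 B i j)) ,
  (λ i → trans (sumℤ-+ (entry B i)) (cong +_ (rowSum B i))) ,
  (λ j → trans (sumℤ-+ (λ i → entry B i j)) (cong +_ (colSum B j)))
  where
  colSum≤1 : ∀ j → sumℕ (λ i → entry B i j) ≤ 1
  colSum≤1 j = subst (_≤ 1) (sym (colSum B j)) (Is01Vec⇒≤1 S01 j)

proposition2p1 : (m n : ℕ) → 1 ≤ m → 1 ≤ n →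
    (R : Fin m → ℕ) (S : Fin n → ℕ) →
    ((∃ λ (A : Matrix m n) → IsSRM A ×
        (((i : Fin m) → rowSums A i ≡ + R i) × ((j : Fin n) → colSums A j ≡ + S j)))
      → (Is01Vec S × sumℕ R ≡ sumℕ S))
    ×
    ((Is01Vec S × sumℕ R ≡ sumℕ S)
      → ∃ λ (A : Matrix m n) → IsSRM A × (Is01Matrix A ×
        (((i : Fin m) → rowSums A i ≡ + R i) × ((j : Fin n) → colSums A j ≡ + S j))))
proposition2p1 m n _ _ R S =
  (λ { (A , srm , rowSums≡R , colSums≡S) →
         SRM-sums⇒Is01Vec×sum≡ R S A srm rowSums≡R colSums≡S }) ,
  (λ { (S01 , sum-R≡sum-S) →
         ZeroOneRealisation⇒SRM S01 (zeroOneRealisation R S S01 sum-R≡sum-S) })
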